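{- Let $d\ge 0$ be an integer and let $G$ be a $d$-degenerate graph. Then $G$ is $\left(d+2, \frac{1}{2^{d+1}}\right)$-flexible.
   Context: All graphs are finite, simple and nonempty. A graph is $d$-degenerate if its vertices can be ordered so that each vertex has at most $d$ neighbors preceding it in the ordering. A list assignment $L$ for $G$ assigns to each vertex $v$ a set $L(v)$ of colors; it is a $k$-assignment if $|L(v)|=k$ for all $v$. A proper $L$-coloring is a function $f$ on $V(G)$ with $f(v)\in L(v)$ for all $v$ and $f(u)\neq f(v)$ whenever $uv\in E(G)$. A request of $L$ is a function $r$ with non-empty domain $D\subseteq V(G)$ such that $r(v)\in L(v)$ for each $v\in D$. For $\epsilon\in(0,1]$, the triple $(G,L,r)$ is $\epsilon$-satisfiable if there is a proper $L$-coloring $f$ of $G$ with $f(v)=r(v)$ for at least $\epsilon|D|$ vertices $v\in D$. $G$ is $(k,\epsilon)$-flexible if $(G,L,r)$ is $\epsilon$-satisfiable for every $k$-assignment $L$ for $G$ and every request $r$ of $L$. -}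

module Defs where

open import Data.Nat using (ℕ; suc; _≤_; _<_; _*_; _^_)
open import Data.Bool using (Bool; true; false; _∧_)
open import Data.Fin using (Fin; toℕ)
open import Data.Fin.Permutation using (Permutation′; _⟨$⟩ʳ_)
open import Data.List using (List; length; filter; allFin)
open import Data.List.Membership.Propositional using (_∈_)
open import Data.List.Relation.Unary.Unique.Propositional using (Unique)
open import Data.Maybe using (Maybe; just; nothing)
open import Data.Product using (Σ; ∃; _×_)
open import Relation.Binary.PropositionalEquality using (_≡_; _≢_)
open import Relation.Nullary using (¬_)
open import Relation.Nullary.Decidable using (does)
open import Data.Nat.Properties using (_≟_; _<?_)
open import Relation.Unary using (Decidable)

record Graph : Set where
  field
    n        : ℕ
    nonempty : 1 ≤ n
    adj      : Fin n → Fin n → Bool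
    sym      : ∀ u v → adj u v ≡ adj v u
    irrefl   : ∀ v → adj v v ≡ false
open Graph public

count : {m : ℕ} → (Fin m → Bool) → ℕ
count {m} p = length (filter (λ v → p v Data.Bool.≟ true) (allFin m))

-- G is d-degenerate: some ordering (a permutation giving each vertex its
-- position) where each vertex has at most d neighbours preceding it.
Degenerate : ℕ → Graph → Set
Degenerate d G =
  Σ (Permutation′ (n G)) λ π →
    ∀ (v : Fin (n G)) →
      count (λ u → adj G u v ∧ does (toℕ (π ⟨$⟩ʳ u) <? toℕ (π ⟨$⟩ʳ v))) ≤ d

ListAssignment : Graph → Set
ListAssignment G = Fin (n G) → List ℕ

IsKAssignment : (G : Graph) → ℕ → ListAssignment G → Set
IsKAssignment G k L = ∀ v → Unique (L v) × length (L v) ≡ k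

IsProperLColoring : (G : Graph) → ListAssignment G → (Fin (n G) → ℕ) → Set
IsProperLColoring G L f =
  (∀ v → f v ∈ L v) × (∀ u v → adj G u v ≡ true → f u ≢ f v)

-- A request: r v = just c means v ∈ D and r(v) = c; D must be nonempty.
Request : Graph → Set
Request G = Fin (n G) → Maybe ℕ

IsRequest : (G : Graph) → ListAssignment G → Request G → Set
IsRequest G L r =
  (∀ v c → r v ≡ just c → c ∈ L v) × ∃ (λ v → r v ≢ nothing)

inDomain : Maybe ℕ → Bool
inDomain (just _) = true
inDomain nothing  = false

satisfied : Maybe ℕ → ℕ → Bool
satisfied (just c) x = does (c ≟ x)
satisfied nothing  x = false

domSize : (G : Graph) → Request G → ℕ
domSize G r = count (λ v → inDomain (r v))

numSatisfied : (G : Graph) → Request G → (Fin (n G) → ℕ) → ℕ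
numSatisfied G r f = count (λ v → satisfied (r v) (f v))

-- (G, L, r) is (1/q)-satisfiable (q ≥ 1): some proper L-colouring f
-- satisfies at least |D|/q requests, i.e. |D| ≤ q * #satisfied.
InvSatisfiable : (G : Graph) → ListAssignment G → Request G → ℕ → Set
InvSatisfiable G L r q =
  Σ (Fin (n G) → ℕ) λ f →
    IsProperLColoring G L f × (domSize G r ≤ q * numSatisfied G r f)

InvFlexible : Graph → ℕ → ℕ → Set
InvFlexible G k q =
  ∀ (L : ListAssignment G) → IsKAssignment G k L →
  ∀ (r : Request G) → IsRequest G L r →
  InvSatisfiable G L r q

-- Order the vertices by the degeneracy ordering and colour them one by one. A vertex w
-- has at most d earlier neighbours, so at least two colours of its (d + 2)-list are
-- unused by them; branch on two such colours, the first being the request of w whenever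
-- possible. This yields 2 ^ n proper colourings, the outcomes of a process in which every
-- vertex makes a fair binary choice. Fix a requested vertex v with request c. Each
-- earlier neighbour u of v avoids c in at least one of its two branches, so at least a
-- 2 ^ -|E(v)| fraction of the outcomes keeps c off the earlier neighbourhood E(v); in
-- each of those, c is free at v and its first branch satisfies the request. Hence v is
-- satisfied in at least 2 ^ (n - d - 1) outcomes; summing over the requested vertices,
-- the average outcome satisfies a 2 ^ -(d + 1) fraction of the requests, and so does
-- the best one.
module Submission where

open import Defs hiding (sym)
open import Data.Bool using (Bool; true; false; T; not; _∧_)
import Data.Bool as Bool
open import Data.Fin using (Fin; toℕ; fromℕ<)
open import Data.Fin.Properties using (toℕ-injective; toℕ-fromℕ<; toℕ<n)
  renaming (_≟_ to _≟ᶠ_)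
open import Data.Fin.Permutation using (Permutation′; _⟨$⟩ʳ_; _⟨$⟩ˡ_; inverseˡ; inverseʳ)
open import Data.List using (List; []; _∷_; [_]; length; map; filter; allFin)
open import Data.List.Extrema.Nat using (argmax; argmax-sel; f[⊥]≤f[argmax]; f[xs]≤f[argmax])
open import Data.List.Membership.Propositional using (_∈_; _∉_)
open import Data.List.Membership.Propositional.Properties
  using (∈-filter⁺; ∈-filter⁻; ∈-map⁺; ∈-map⁻; ∈-allFin)
import Data.List.Membership.DecPropositional as DecMembership
open import Data.List.Properties using (filter-notAll; length-map; map-cong; map-cong-local)
open import Data.List.Relation.Binary.Subset.Propositional using (_⊆_)
open import Data.List.Relation.Unary.All as All using (All; []; _∷_)
open import Data.List.Relation.Unary.Any as Any using (here; there)
open import Data.List.Relation.Unary.AllPairs using (_∷_)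
open import Data.List.Relation.Unary.Unique.Propositional using (Unique)
import Data.List.Relation.Unary.Unique.Propositional.Properties as Unique
open import Data.Maybe using (Maybe; just; nothing)
open import Data.Nat using (ℕ; zero; suc; _+_; _*_; _^_; _≤_; _<_; z≤n; s≤s; s≤s⁻¹)
open import Data.Nat.ListAction using (sum)
open import Data.Nat.Properties
open import Algebra.Properties.CommutativeSemigroup +-commutativeSemigroup using (interchange)
open import Algebra.Properties.CommutativeSemigroup *-commutativeSemigroup
  using (x∙yz≈y∙xz; xy∙z≈zy∙x)
open import Data.Product using (∃-syntax; _×_; _,_; proj₁; proj₂)
open import Data.Sum as Sum using (_⊎_; inj₁; inj₂; [_,_]′)
open import Data.Vec.Functional using (updateAt)
open import Data.Vec.Functional.Properties using (updateAt-updates; updateAt-minimal)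
open import Function using (const; _∘_)
open import Relation.Binary using (tri<; tri≈; tri>)
open import Relation.Binary.Definitions using (DecidableEquality)
open import Relation.Binary.PropositionalEquality
  using (_≡_; _≢_; refl; sym; trans; cong; cong₂; subst; module ≡-Reasoning)
open import Relation.Nullary using (Dec; yes; no; does; ¬?; contradiction)
open import Relation.Nullary.Decidable using (dec-true; decidable-stable)
open import Relation.Unary using (Decidable)
open import Relation.Unary.Properties using (∁?)

indicator : Bool → ℕ
indicator true  = 1
indicator false = 0

indicator-T : ∀ {b} → T b → indicator b ≡ 1
indicator-T {true} _ = refl

indicator-⊎ : ∀ {a b} → T a ⊎ T b → 1 ≤ indicator a + indicator b
indicator-⊎ {true}          _        = s≤s z≤n
indicator-⊎ {false} {true}  _        = s≤s z≤n
indicator-⊎ {false} {false} (inj₁ ())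
indicator-⊎ {false} {false} (inj₂ ())

m≤n+o+m : ∀ m n o → m ≤ n + (o + m)
m≤n+o+m m n o = ≤-trans (m≤n+m m o) (m≤n+m (o + m) n)

∧-does⁻ : ∀ b {P : Set} (P? : Dec P) → b ∧ does P? ≡ true → P
∧-does⁻ true (yes p) _ = p

double-≤ˡ : ∀ {a} b {b′} c → a ≤ b * c → 2 * b ≤ b′ → 2 * a ≤ b′ * c
double-≤ˡ {a} b {b′} c a≤bc 2b≤b′ = begin
  2 * a       ≤⟨ *-monoʳ-≤ 2 a≤bc ⟩
  2 * (b * c) ≡⟨ *-assoc 2 b c ⟨
  2 * b * c   ≤⟨ *-monoˡ-≤ c 2b≤b′ ⟩
  b′ * c      ∎
  where open ≤-Reasoning

double-≤ʳ : ∀ {a} b {b′} c → a ≤ b * c → b ≤ b′ → 2 * a ≤ b′ * (2 * c)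
double-≤ʳ {a} b {b′} c a≤bc b≤b′ = begin
  2 * a        ≤⟨ *-monoʳ-≤ 2 a≤bc ⟩
  2 * (b * c)  ≡⟨ x∙yz≈y∙xz 2 b c ⟩
  b * (2 * c)  ≤⟨ *-monoˡ-≤ (2 * c) b≤b′ ⟩
  b′ * (2 * c) ∎
  where open ≤-Reasoning

module _ {A : Set} where

  countᵇ : (A → Bool) → List A → ℕ
  countᵇ p xs = sum (map (indicator ∘ p) xs)

  length-filter≡countᵇ : ∀ (p : A → Bool) xs →
                         length (filter (λ x → p x Bool.≟ true) xs) ≡ countᵇ p xs
  length-filter≡countᵇ p []       = refl
  length-filter≡countᵇ p (x ∷ xs) with p x
  ... | true  = cong suc (length-filter≡countᵇ p xs)
  ... | false = length-filter≡countᵇ p xs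

  length-filter+length-filter-∁ : ∀ {P : A → Set} (P? : Decidable P) xs →
    length (filter P? xs) + length (filter (∁? P?) xs) ≡ length xs
  length-filter+length-filter-∁ P? []       = refl
  length-filter+length-filter-∁ P? (x ∷ xs) with P? x
  ... | yes _ = cong suc (length-filter+length-filter-∁ P? xs)
  ... | no  _ = trans (+-suc _ _) (cong suc (length-filter+length-filter-∁ P? xs))

  sum-map-0 : ∀ (xs : List A) → sum (map (λ _ → 0) xs) ≡ 0
  sum-map-0 []       = refl
  sum-map-0 (_ ∷ xs) = sum-map-0 xs

  sum-map-+ : ∀ (f g : A → ℕ) xs →
              sum (map (λ x → f x + g x) xs) ≡ sum (map f xs) + sum (map g xs)
  sum-map-+ f g []       = refl
  sum-map-+ f g (x ∷ xs) =
    trans (cong (f x + g x +_) (sum-map-+ f g xs)) (interchange (f x) (g x) _ _)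

  sum-map-*ʳ : ∀ (f : A → ℕ) k xs → sum (map (λ x → f x * k) xs) ≡ sum (map f xs) * k
  sum-map-*ʳ f k []       = refl
  sum-map-*ʳ f k (x ∷ xs) =
    trans (cong (f x * k +_) (sum-map-*ʳ f k xs)) (sym (*-distribʳ-+ k (f x) _))

  sum-map-mono : ∀ {f g : A → ℕ} xs → (∀ x → f x ≤ g x) → sum (map f xs) ≤ sum (map g xs)
  sum-map-mono []       f≤g = z≤n
  sum-map-mono (x ∷ xs) f≤g = +-mono-≤ (f≤g x) (sum-map-mono xs f≤g)

  sum-map-≤ : ∀ {f : A → ℕ} {m xs} → All (λ x → f x ≤ m) xs → sum (map f xs) ≤ length xs * m
  sum-map-≤ []             = z≤n
  sum-map-≤ (fx≤m ∷ fxs≤m) = +-mono-≤ fx≤m (sum-map-≤ fxs≤m)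

  ∃-≥-average : ∀ (f : A → ℕ) xs → 0 < length xs →
                ∃[ y ] y ∈ xs × sum (map f xs) ≤ length xs * f y
  ∃-≥-average f (x ∷ xs) _ =
    argmax f x xs ,
    [ here , there ]′ (argmax-sel f x xs) ,
    sum-map-≤ (f[⊥]≤f[argmax] {f = f} x xs ∷ f[xs]≤f[argmax] {f = f} x xs)

sum-map-comm : ∀ {A B : Set} (f : A → B → ℕ) xs ys →
  sum (map (λ y → sum (map (λ x → f x y) xs)) ys) ≡ sum (map (λ x → sum (map (f x) ys)) xs)
sum-map-comm f xs []       = sym (sum-map-0 xs)
sum-map-comm f xs (y ∷ ys) =
  trans (cong (sum (map (λ x → f x y) xs) +_) (sum-map-comm f xs ys))
        (sym (sum-map-+ (λ x → f x y) (λ x → sum (map (f x) ys)) xs))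

module _ {A : Set} (children : A → A × A) where

  branch : List A → List A
  branch []       = []
  branch (x ∷ xs) = proj₁ (children x) ∷ proj₂ (children x) ∷ branch xs

  length-branch : ∀ xs → length (branch xs) ≡ 2 * length xs
  length-branch []       = refl
  length-branch (x ∷ xs) = trans (cong (2 +_) (length-branch xs)) (sym (*-suc 2 (length xs)))

  All-branch : ∀ {P Q : A → Set} →
               (∀ {x} → P x → Q (proj₁ (children x)) × Q (proj₂ (children x))) →
               ∀ {xs} → All P xs → All Q (branch xs)
  All-branch PQ []         = []
  All-branch PQ (px ∷ pxs) = proj₁ (PQ px) ∷ proj₂ (PQ px) ∷ All-branch PQ pxs

  countᵇ-branch-one : ∀ (p q : A → Bool) →
    (∀ x → T (p x) → T (q (proj₁ (children x))) ⊎ T (q (proj₂ (children x)))) →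
    ∀ xs → countᵇ p xs ≤ countᵇ q (branch xs)
  countᵇ-branch-one p q one []       = z≤n
  countᵇ-branch-one p q one (x ∷ xs) with p x | one x
  ... | true  | one-x =
    ≤-trans (+-mono-≤ (indicator-⊎ (one-x _)) (countᵇ-branch-one p q one xs))
            (≤-reflexive (+-assoc (indicator (q (proj₁ (children x)))) _ _))
  ... | false | _     =
    ≤-trans (countᵇ-branch-one p q one xs)
            (m≤n+o+m _ (indicator (q (proj₁ (children x)))) (indicator (q (proj₂ (children x)))))

  countᵇ-branch-both : ∀ (p q : A → Bool) →
    (∀ x → T (p x) → T (q (proj₁ (children x))) × T (q (proj₂ (children x)))) →
    ∀ xs → 2 * countᵇ p xs ≤ countᵇ q (branch xs)
  countᵇ-branch-both p q both []       = z≤n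
  countᵇ-branch-both p q both (x ∷ xs) with p x | both x
  ... | true  | both-x = begin
      2 * suc (countᵇ p xs)    ≡⟨ *-suc 2 _ ⟩
      2 + 2 * countᵇ p xs      ≤⟨ +-monoʳ-≤ 2 (countᵇ-branch-both p q both xs) ⟩
      2 + countᵇ q (branch xs) ≡⟨ cong₂ (λ i j → i + (j + countᵇ q (branch xs)))
                                         (sym (indicator-T (proj₁ (both-x _))))
                                         (sym (indicator-T (proj₂ (both-x _)))) ⟩
      countᵇ q (branch (x ∷ xs)) ∎
    where open ≤-Reasoning
  ... | false | _      =
    ≤-trans (countᵇ-branch-both p q both xs)
            (m≤n+o+m _ (indicator (q (proj₁ (children x)))) (indicator (q (proj₂ (children x)))))

module DistinctChoices {A : Set} (_≟_ : DecidableEquality A) where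

  open DecMembership _≟_ using (_∈?_; _∉?_)

  Unique-⊆⇒length≤ : ∀ {xs ys : List A} → Unique xs → xs ⊆ ys → length xs ≤ length ys
  Unique-⊆⇒length≤ {[]}     _             _         = z≤n
  Unique-⊆⇒length≤ {x ∷ xs} {ys} (x∉xs ∷ xs!) x∷xs⊆ys =
    ≤-trans (s≤s (Unique-⊆⇒length≤ xs! xs⊆ys-x))
            (filter-notAll ≢x? ys (Any.map (λ x≡y y≢x → y≢x (sym x≡y)) (x∷xs⊆ys (here refl))))
    where
      ≢x? = λ y → ¬? (y ≟ x)
      xs⊆ys-x : xs ⊆ filter ≢x? ys
      xs⊆ys-x y∈xs =
        ∈-filter⁺ ≢x? (x∷xs⊆ys (there y∈xs)) (λ y≡x → All.lookup x∉xs y∈xs (sym y≡x))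

  length≤length-filter-∉+length : ∀ {xs} ys → Unique xs →
    length xs ≤ length (filter (_∉? ys) xs) + length ys
  length≤length-filter-∉+length {xs} ys xs! = begin
    length xs
      ≡⟨ length-filter+length-filter-∁ (_∉? ys) xs ⟨
    length (filter (_∉? ys) xs) + length (filter (∁? (_∉? ys)) xs)
      ≤⟨ +-monoʳ-≤ _ (Unique-⊆⇒length≤ (Unique.filter⁺ (∁? (_∉? ys)) xs!) rest⊆ys) ⟩
    length (filter (_∉? ys) xs) + length ys ∎
    where
      open ≤-Reasoning
      rest⊆ys : filter (∁? (_∉? ys)) xs ⊆ ys
      rest⊆ys {x} x∈ = decidable-stable (x ∈? ys) (proj₂ (∈-filter⁻ (∁? (_∉? ys)) {xs = xs} x∈))

  record TwoChoices (xs : List A) (preferred : Maybe A) : Set where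
    constructor choose
    field
      first second    : A
      first∈          : first ∈ xs
      second∈         : second ∈ xs
      first≢second    : first ≢ second
      first-preferred : ∀ {c} → preferred ≡ just c → c ∈ xs → first ≡ c

  first≢∨second≢ : ∀ {xs t} (ch : TwoChoices xs t) c →
                   TwoChoices.first ch ≢ c ⊎ TwoChoices.second ch ≢ c
  first≢∨second≢ ch c with TwoChoices.first ch ≟ c
  ... | yes refl = inj₂ (TwoChoices.first≢second ch ∘ sym)
  ... | no first≢c = inj₁ first≢c

  twoChoices : ∀ {xs} → Unique xs → 2 ≤ length xs → ∀ preferred → TwoChoices xs preferred
  twoChoices {[]}    _ ()        _
  twoChoices {_ ∷ []} _ (s≤s ()) _
  twoChoices {x ∷ y ∷ _} ((x≢y ∷ _) ∷ _) _ nothing =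
    choose x y (here refl) (there (here refl)) x≢y λ ()
  twoChoices {xs@(x ∷ y ∷ _)} ((x≢y ∷ _) ∷ _) _ (just c) with c ∈? xs | x ≟ c
  ... | no c∉xs  | _         =
    choose x y (here refl) (there (here refl)) x≢y λ { refl c∈xs → contradiction c∈xs c∉xs }
  ... | yes c∈xs | yes refl  = choose c y c∈xs (there (here refl)) x≢y λ { refl _ → refl }
  ... | yes c∈xs | no x≢c    = choose c x c∈xs (here refl) (x≢c ∘ sym) λ { refl _ → refl }

module FlexibleColouring
  (G : Graph) (d : ℕ) (degenerate : Degenerate d G)
  (L : ListAssignment G) (L-size : IsKAssignment G (d + 2) L)
  (r : Request G) (r∈L : ∀ v c → r v ≡ just c → c ∈ L v) where

  open DistinctChoices _≟_
  open DecMembership _≟_ using (_∈?_; _∉?_)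
  open DecMembership (_≟ᶠ_ {n G}) using () renaming (_∈?_ to _∈?ᶠ_)

  V : Set
  V = Fin (n G)

  -- Vertices not yet reached by the colouring process carry a junk colour.
  Colouring : Set
  Colouring = V → ℕ

  π : Permutation′ (n G)
  π = proj₁ degenerate

  pos : V → ℕ
  pos v = toℕ (π ⟨$⟩ʳ v)

  vertexAt : (k : ℕ) → .(k < n G) → V
  vertexAt k k<n = π ⟨$⟩ˡ fromℕ< k<n

  pos-vertexAt : ∀ k .(k<n : k < n G) → pos (vertexAt k k<n) ≡ k
  pos-vertexAt k k<n = trans (cong toℕ (inverseʳ π)) (toℕ-fromℕ< k<n)

  pos-injective : ∀ {u v} → pos u ≡ pos v → u ≡ v
  pos-injective {u} {v} eq = begin
    u                 ≡⟨ inverseˡ π ⟨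
    π ⟨$⟩ˡ (π ⟨$⟩ʳ u) ≡⟨ cong (π ⟨$⟩ˡ_) (toℕ-injective eq) ⟩
    π ⟨$⟩ˡ (π ⟨$⟩ʳ v) ≡⟨ inverseˡ π ⟩
    v                 ∎
    where open ≡-Reasoning

  vertexAt-pos : ∀ v .(v<n : pos v < n G) → vertexAt (pos v) v<n ≡ v
  vertexAt-pos v v<n = pos-injective (pos-vertexAt (pos v) v<n)

  pos<suc⇒pos< : ∀ {u w k} → pos w ≡ k → pos u < suc k → u ≢ w → pos u < k
  pos<suc⇒pos< refl u<sk u≢w = ≤∧≢⇒< (s≤s⁻¹ u<sk) (u≢w ∘ pos-injective)

  earlierNeighbour : V → V → Bool
  earlierNeighbour u v = adj G u v ∧ does (pos u <? pos v)

  earlier : V → List V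
  earlier v = filter (λ u → earlierNeighbour u v Bool.≟ true) (allFin (n G))

  length-earlier : ∀ v → length (earlier v) ≤ d
  length-earlier = proj₂ degenerate

  ∈-earlier⁻ : ∀ {u v} → u ∈ earlier v → pos u < pos v
  ∈-earlier⁻ {u} {v} u∈ = ∧-does⁻ (adj G u v) (pos u <? pos v)
    (proj₂ (∈-filter⁻ (λ u → earlierNeighbour u v Bool.≟ true) {xs = allFin (n G)} u∈))

  ∈-earlier⁺ : ∀ {u v} → adj G u v ≡ true → pos u < pos v → u ∈ earlier v
  ∈-earlier⁺ {u} {v} uv u<v =
    ∈-filter⁺ (λ u → earlierNeighbour u v Bool.≟ true) (∈-allFin u)
              (cong₂ _∧_ uv (dec-true (pos u <? pos v) u<v))

  adjacent⇒earlier : ∀ {u v} → adj G u v ≡ true → u ∈ earlier v ⊎ v ∈ earlier u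
  adjacent⇒earlier {u} {v} uv with <-cmp (pos u) (pos v)
  ... | tri< u<v _ _ = inj₁ (∈-earlier⁺ uv u<v)
  ... | tri≈ _ u≡v _ with refl ← pos-injective u≡v = contradiction (trans (sym uv) (irrefl G u)) λ ()
  ... | tri> _ _ v<u = inj₂ (∈-earlier⁺ (trans (Graph.sym G v u) uv) v<u)

  _[_≔_] : Colouring → V → ℕ → Colouring
  g [ w ≔ z ] = updateAt g w (const z)

  ≔-updates : ∀ g w z → (g [ w ≔ z ]) w ≡ z
  ≔-updates g w z = updateAt-updates w g

  ≔-minimal : ∀ g {w u} z → u ≢ w → (g [ w ≔ z ]) u ≡ g u
  ≔-minimal g {w} {u} z u≢w = updateAt-minimal u w g u≢w

  free : Colouring → V → List ℕ
  free g w = filter (_∉? map g (earlier w)) (L w)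

  2≤length-free : ∀ g w → 2 ≤ length (free g w)
  2≤length-free g w = +-cancelʳ-≤ d 2 (length (free g w)) (begin
    2 + d
      ≡⟨ +-comm 2 d ⟩
    d + 2
      ≡⟨ proj₂ (L-size w) ⟨
    length (L w)
      ≤⟨ length≤length-filter-∉+length (map g (earlier w)) (proj₁ (L-size w)) ⟩
    length (free g w) + length (map g (earlier w))
      ≡⟨ cong (length (free g w) +_) (length-map g (earlier w)) ⟩
    length (free g w) + length (earlier w)
      ≤⟨ +-monoʳ-≤ (length (free g w)) (length-earlier w) ⟩
    length (free g w) + d ∎)
    where open ≤-Reasoning

  choices : (g : Colouring) (w : V) → TwoChoices (free g w) (r w)
  choices g w =
    twoChoices (Unique.filter⁺ (_∉? map g (earlier w)) (proj₁ (L-size w))) (2≤length-free g w) (r w)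

  extend : V → Colouring → Colouring × Colouring
  extend w g = g [ w ≔ first ] , g [ w ≔ second ]
    where open TwoChoices (choices g w)

  -- The bound is irrelevant, so outcomes k does not depend on which proof of it is given.
  outcomes : (k : ℕ) → .(k ≤ n G) → List Colouring
  outcomes zero    _   = [ const 0 ]
  outcomes (suc k) k<n = branch (extend (vertexAt k k<n)) (outcomes k (<⇒≤ k<n))

  length-outcomes : ∀ k .(k≤n : k ≤ n G) → length (outcomes k k≤n) ≡ 2 ^ k
  length-outcomes zero    _   = refl
  length-outcomes (suc k) k<n =
    trans (length-branch (extend (vertexAt k k<n)) (outcomes k _))
          (cong (2 *_) (length-outcomes k _))

  ProperBelow : ℕ → Colouring → Set
  ProperBelow k g = (∀ u → pos u < k → g u ∈ L u)
                  × (∀ u v → u ∈ earlier v → pos v < k → g u ≢ g v)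

  ProperBelow-≔ : ∀ {k g w z} → pos w ≡ k → ProperBelow k g → z ∈ free g w →
                  ProperBelow (suc k) (g [ w ≔ z ])
  ProperBelow-≔ {k} {g} {w} {z} w≡k (coloured , proper) z∈free = coloured′ , proper′
    where
      z∈Lw : z ∈ L w
      z∈Lw = proj₁ (∈-filter⁻ (_∉? map g (earlier w)) {xs = L w} z∈free)
      z∉used : z ∉ map g (earlier w)
      z∉used = proj₂ (∈-filter⁻ (_∉? map g (earlier w)) {xs = L w} z∈free)

      coloured′ : ∀ u → pos u < suc k → (g [ w ≔ z ]) u ∈ L u
      coloured′ u u<sk with u ≟ᶠ w
      ... | yes refl = subst (_∈ L u) (sym (≔-updates g u z)) z∈Lw
      ... | no u≢w   =
        subst (_∈ L u) (sym (≔-minimal g z u≢w)) (coloured u (pos<suc⇒pos< w≡k u<sk u≢w))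

      earlier-≢ : ∀ {u v} → u ∈ earlier v → pos v < suc k → u ≢ w
      earlier-≢ u∈ v<sk refl = <-irrefl w≡k (<-≤-trans (∈-earlier⁻ u∈) (s≤s⁻¹ v<sk))

      proper′ : ∀ u v → u ∈ earlier v → pos v < suc k → (g [ w ≔ z ]) u ≢ (g [ w ≔ z ]) v
      proper′ u v u∈ v<sk g′u≡g′v with v ≟ᶠ w | ≔-minimal g z (earlier-≢ u∈ v<sk)
      ... | yes refl | g′u≡gu = z∉used (subst (_∈ map g (earlier v)) gu≡z (∈-map⁺ g u∈))
        where gu≡z = trans (sym g′u≡gu) (trans g′u≡g′v (≔-updates g v z))
      ... | no v≢w   | g′u≡gu = proper u v u∈ (pos<suc⇒pos< w≡k v<sk v≢w)
                                       (trans (sym g′u≡gu) (trans g′u≡g′v (≔-minimal g z v≢w)))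

  outcomes-proper : ∀ k .(k≤n : k ≤ n G) → All (ProperBelow k) (outcomes k k≤n)
  outcomes-proper zero    _   = ((λ _ ()) , (λ _ _ _ ())) ∷ []
  outcomes-proper (suc k) k<n =
    All-branch (extend w) (λ {g} below → ProperBelow-≔ w≡k below (TwoChoices.first∈ (choices g w))
                                       , ProperBelow-≔ w≡k below (TwoChoices.second∈ (choices g w)))
               (outcomes-proper k _)
    where
      w = vertexAt k k<n
      w≡k = pos-vertexAt k k<n

  ProperBelow⇒proper : ∀ {g} → ProperBelow (n G) g → IsProperLColoring G L g
  ProperBelow⇒proper (coloured , proper) =
    (λ v → coloured v (toℕ<n _)) ,
    λ u v uv → [ (λ u∈ → proper u v u∈ (toℕ<n _))
               , (λ v∈ → proper v u v∈ (toℕ<n _) ∘ sym)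
               ]′ (adjacent⇒earlier uv)

  avoids : ℕ → List V → Colouring → Bool
  avoids c X g = not (does (c ∈? map g X))

  avoids⁻ : ∀ {c} {X : List V} {g : Colouring} → T (not (does (c ∈? map g X))) → c ∉ map g X
  avoids⁻ {c} {X} {g} avoid with c ∈? map g X
  ... | no c∉ = c∉

  avoids⁺ : ∀ {c} {X : List V} {g : Colouring} → c ∉ map g X → T (not (does (c ∈? map g X)))
  avoids⁺ {c} {X} {g} c∉ with c ∈? map g X
  ... | yes c∈ = c∉ c∈
  ... | no _   = _

  avoids-≔-∉ : ∀ c X g {w} z → w ∉ X → avoids c X (g [ w ≔ z ]) ≡ avoids c X g
  avoids-≔-∉ c X g z w∉X = cong (λ ys → not (does (c ∈? ys))) (map-cong-local (All.tabulate untouched))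
    where
      untouched : ∀ {x} → x ∈ X → (g [ _ ≔ z ]) x ≡ g x
      untouched x∈X = ≔-minimal g z λ { refl → w∉X x∈X }

  ∉-map-≔ : ∀ {c g w z} X → c ∉ map g (filter (λ x → ¬? (x ≟ᶠ w)) X) → z ≢ c →
            c ∉ map (g [ w ≔ z ]) X
  ∉-map-≔ {c} {g} {w} {z} X c∉ z≢c c∈ with ∈-map⁻ (g [ w ≔ z ]) c∈
  ... | x , x∈X , c≡ with x ≟ᶠ w
  ...   | yes refl = z≢c (sym (trans c≡ (≔-updates g x z)))
  ...   | no x≢w   = c∉ (subst (_∈ _) (sym (trans c≡ (≔-minimal g z x≢w)))
                                (∈-map⁺ g (∈-filter⁺ (λ x → ¬? (x ≟ᶠ w)) x∈X x≢w)))

  -- Each vertex of X halves, at worst, the share of outcomes keeping c off X.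
  avoids-bound : ∀ k .(k≤n : k ≤ n G) c X → All (λ x → pos x < k) X →
                 2 ^ k ≤ countᵇ (avoids c X) (outcomes k k≤n) * 2 ^ length X
  avoids-bound zero    _   c [] [] = s≤s z≤n
  avoids-bound (suc k) k<n c X X<sk with vertexAt k k<n ∈?ᶠ X
  ... | no w∉X = double-≤ˡ C (2 ^ length X) (avoids-bound k _ c X (All.tabulate X<k))
                           (countᵇ-branch-both (extend w) _ _ both (outcomes k _))
    where
      w = vertexAt k k<n
      C = countᵇ (avoids c X) (outcomes k _)
      X<k : ∀ {x} → x ∈ X → pos x < k
      X<k x∈X = pos<suc⇒pos< (pos-vertexAt k k<n) (All.lookup X<sk x∈X) λ { refl → w∉X x∈X }
      both : ∀ g → T (avoids c X g) →
             T (avoids c X (proj₁ (extend w g))) × T (avoids c X (proj₂ (extend w g)))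
      both g avoid = kept _ , kept _
        where
          kept : ∀ z → T (avoids c X (g [ w ≔ z ]))
          kept z = subst T (sym (avoids-≔-∉ c X g z w∉X)) avoid
  ... | yes w∈X = begin
      2 * 2 ^ k
        ≤⟨ double-≤ʳ C₀ (2 ^ length X₀) (avoids-bound k _ c X₀ (All.tabulate X₀<k))
                     (countᵇ-branch-one (extend w) _ _ one (outcomes k _)) ⟩
      C * 2 ^ suc (length X₀)
        ≤⟨ *-monoʳ-≤ C (^-monoʳ-≤ 2 X₀-shorter) ⟩
      C * 2 ^ length X ∎
    where
      open ≤-Reasoning
      w = vertexAt k k<n
      ≢w? : Decidable (_≢ w)
      ≢w? x = ¬? (x ≟ᶠ w)
      X₀ : List V
      X₀ = filter ≢w? X
      C₀ = countᵇ (avoids c X₀) (outcomes k _)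
      C = countᵇ (avoids c X) (outcomes (suc k) k<n)
      X₀-shorter : length X₀ < length X
      X₀-shorter = filter-notAll ≢w? X (Any.map (λ w≡x x≢w → x≢w (sym w≡x)) w∈X)
      X₀<k : ∀ {x} → x ∈ X₀ → pos x < k
      X₀<k x∈X₀ = let x∈X , x≢w = ∈-filter⁻ ≢w? {xs = X} x∈X₀ in
        pos<suc⇒pos< (pos-vertexAt k k<n) (All.lookup X<sk x∈X) x≢w
      one : ∀ g → T (avoids c X₀ g) →
            T (avoids c X (proj₁ (extend w g))) ⊎ T (avoids c X (proj₂ (extend w g)))
      one g avoid = Sum.map kept kept (first≢∨second≢ (choices g w) c)
        where
          kept : ∀ {z} → z ≢ c → T (avoids c X (g [ w ≔ z ]))
          kept = avoids⁺ ∘ ∉-map-≔ X (avoids⁻ avoid)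

  colours : V → ℕ → Colouring → Bool
  colours v c g = does (c ≟ g v)

  colours⁺ : ∀ {v c g} → c ≡ g v → T (colours v c g)
  colours⁺ {v} {c} {g} c≡gv = subst T (sym (dec-true (c ≟ g v) c≡gv)) _

  colours-request-bound : ∀ {v c} → r v ≡ just c → ∀ k .(k≤n : k ≤ n G) → pos v < k →
    2 ^ k ≤ countᵇ (colours v c) (outcomes k k≤n) * 2 ^ suc (length (earlier v))
  colours-request-bound {v} {c} rv≡c (suc k) k<n v<sk with m≤n⇒m<n∨m≡n (s≤s⁻¹ v<sk)
  ... | inj₁ v<k =
    double-≤ˡ C (2 ^ suc (length (earlier v))) (colours-request-bound rv≡c k _ v<k)
              (countᵇ-branch-both (extend w) _ _ both (outcomes k _))
    where
      w = vertexAt k k<n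
      C = countᵇ (colours v c) (outcomes k _)
      v≢w : v ≢ w
      v≢w refl = <-irrefl (pos-vertexAt k k<n) v<k
      both : ∀ g → T (colours v c g) →
             T (colours v c (proj₁ (extend w g))) × T (colours v c (proj₂ (extend w g)))
      both g cv = kept _ , kept _
        where
          kept : ∀ z → T (colours v c (g [ w ≔ z ]))
          kept z = subst (T ∘ does ∘ (c ≟_)) (sym (≔-minimal g z v≢w)) cv
  ... | inj₂ refl =
    double-≤ʳ C (2 ^ length (earlier v))
              (avoids-bound (pos v) _ c (earlier v) (All.tabulate ∈-earlier⁻))
              (countᵇ-branch-one (extend w) _ _ (λ g → inj₁ ∘ first-satisfies g) (outcomes (pos v) _))
    where
      w = vertexAt (pos v) k<n
      C = countᵇ (avoids c (earlier v)) (outcomes (pos v) _)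
      first-satisfies : ∀ g → T (avoids c (earlier v) g) → T (colours v c (proj₁ (extend w g)))
      first-satisfies g avoid rewrite vertexAt-pos v k<n = colours⁺ {g = g [ v ≔ first ]} (sym (begin
        (g [ v ≔ first ]) v ≡⟨ ≔-updates g v first ⟩
        first               ≡⟨ first-preferred rv≡c (∈-filter⁺ (_∉? _) (r∈L v c rv≡c) (avoids⁻ avoid)) ⟩
        c                   ∎))
        where
          open ≡-Reasoning
          open TwoChoices (choices g v)

  colourings : List Colouring
  colourings = outcomes (n G) ≤-refl

  inDomain-bound : ∀ v → indicator (inDomain (r v)) * 2 ^ n G
                       ≤ countᵇ (λ g → satisfied (r v) (g v)) colourings * 2 ^ (d + 1)
  inDomain-bound v with r v in rv≡c
  ... | nothing = z≤n
  ... | just c  = begin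
    1 * 2 ^ n G
      ≡⟨ *-identityˡ _ ⟩
    2 ^ n G
      ≤⟨ colours-request-bound rv≡c (n G) _ (toℕ<n _) ⟩
    C * 2 ^ suc (length (earlier v))
      ≤⟨ *-monoʳ-≤ C (^-monoʳ-≤ 2 (≤-trans (s≤s (length-earlier v)) (≤-reflexive (+-comm 1 d)))) ⟩
    C * 2 ^ (d + 1) ∎
    where
      open ≤-Reasoning
      C = countᵇ (colours v c) colourings

  domSize-bound : domSize G r * 2 ^ n G ≤ sum (map (numSatisfied G r) colourings) * 2 ^ (d + 1)
  domSize-bound = begin
    domSize G r * 2 ^ n G
      ≡⟨ cong (_* 2 ^ n G) (length-filter≡countᵇ _ vs) ⟩
    countᵇ (λ v → inDomain (r v)) vs * 2 ^ n G
      ≡⟨ sum-map-*ʳ (λ v → indicator (inDomain (r v))) _ vs ⟨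
    sum (map (λ v → indicator (inDomain (r v)) * 2 ^ n G) vs)
      ≤⟨ sum-map-mono vs inDomain-bound ⟩
    sum (map (λ v → countᵇ (satisfies v) colourings * 2 ^ (d + 1)) vs)
      ≡⟨ sum-map-*ʳ (λ v → countᵇ (satisfies v) colourings) _ vs ⟩
    sum (map (λ v → countᵇ (satisfies v) colourings) vs) * 2 ^ (d + 1)
      ≡⟨ cong (_* 2 ^ (d + 1)) (sum-map-comm (λ v g → indicator (satisfies v g)) vs colourings) ⟨
    sum (map (λ g → countᵇ (λ v → satisfies v g) vs) colourings) * 2 ^ (d + 1)
      ≡⟨ cong (λ m → sum m * 2 ^ (d + 1)) (map-cong (λ g → length-filter≡countᵇ _ vs) colourings) ⟨
    sum (map (numSatisfied G r) colourings) * 2 ^ (d + 1) ∎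
    where
      open ≤-Reasoning
      vs = allFin (n G)
      satisfies : V → Colouring → Bool
      satisfies v g = satisfied (r v) (g v)

  satisfiable : InvSatisfiable G L r (2 ^ (d + 1))
  satisfiable with ∃-≥-average (numSatisfied G r) colourings
                    (subst (0 <_) (sym (length-outcomes (n G) _)) (m^n>0 2 (n G)))
  ... | g , g∈ , average = g , ProperBelow⇒proper (All.lookup (outcomes-proper (n G) _) g∈) , bound
    where
      bound : domSize G r ≤ 2 ^ (d + 1) * numSatisfied G r g
      bound = *-cancelʳ-≤ _ _ (2 ^ n G) {{m^n≢0 2 (n G)}} (begin
        domSize G r * 2 ^ n G
          ≤⟨ domSize-bound ⟩
        sum (map (numSatisfied G r) colourings) * 2 ^ (d + 1)
          ≤⟨ *-monoˡ-≤ _ average ⟩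
        length colourings * numSatisfied G r g * 2 ^ (d + 1)
          ≡⟨ cong (λ m → m * _ * _) (length-outcomes (n G) _) ⟩
        2 ^ n G * numSatisfied G r g * 2 ^ (d + 1)
          ≡⟨ xy∙z≈zy∙x (2 ^ n G) _ _ ⟩
        2 ^ (d + 1) * numSatisfied G r g * 2 ^ n G ∎)
        where open ≤-Reasoning

theorem4 : ∀ (d : ℕ) (G : Graph) → Degenerate d G →
    InvFlexible G (d + 2) (2 ^ (d + 1))
theorem4 d G degenerate L L-size r (r∈L , _) =
  FlexibleColouring.satisfiable G d degenerate L L-size r r∈L
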